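{- Let $k$ be a positive integer. Let $A$ be a set of positive integers such that $\{a, a+k\} \subseteq A$ for infinitely many $a \in A$, and such that $\{a, a+k\} \cap A \neq \emptyset$ for every positive integer $a$. Then $A$ contains infinitely many subsets of the form $\{a, ax^2\}$ for some integer $x \geq 2$. -}

module Defs where

open import Data.Nat using (ℕ; _+_; _*_; _≤_)
open import Data.Product using (∃-syntax; _×_)

InfinitelyMany : (ℕ → Set) → Set
InfinitelyMany P = ∀ (N : ℕ) → ∃[ n ] (N ≤ n × P n)

{-# OPTIONS --safe #-}
-- Start from any a ∈ A and write a x² = k u (take x = k r).  Covering at a x² gives either
-- a x² ∈ A, a pair already, or a x² + k ∈ A.  In the second case cover at a w² with
-- w = x (4u + 3): either a w² ∈ A, or a w² + k ∈ A, and the cubic identity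
-- u (4u + 3)² + 1 = (u + 1)(4u + 1)² turns a w² + k into (a x² + k)(4u + 1)², so the
-- pair is {a x² + k, (a x² + k)(4u + 1)²}.  All three candidates lie above a x², which
-- can be made as large as we like.
module Submission where

open import Defs
open import Data.Nat using (ℕ; zero; suc; _+_; _*_; _≤_; s≤s; z≤n; >-nonZero)
open import Data.Nat.Properties
open import Data.Nat.Tactic.RingSolver using (solve-∀)
open import Data.Product using (∃-syntax; _×_; _,_)
open import Data.Sum using (_⊎_; inj₁; inj₂)
open import Relation.Binary.PropositionalEquality using (_≡_; cong; sym; subst; module ≡-Reasoning)

SquarePairAbove : (ℕ → Set) → ℕ → Set
SquarePairAbove A N = ∃[ b ] ∃[ y ] (2 ≤ y × N ≤ b * (y * y) × A b × A (b * (y * y)))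

ku[4u+3]²+k≡[ku+k][4u+1]² : ∀ k u →
  k * u * ((3 + 4 * u) * (3 + 4 * u)) + k ≡ (k * u + k) * ((1 + 4 * u) * (1 + 4 * u))
ku[4u+3]²+k≡[ku+k][4u+1]² = solve-∀

a[xs]²≡ax²s² : ∀ a x s → a * ((x * s) * (x * s)) ≡ a * (x * x) * (s * s)
a[xs]²≡ax²s² = solve-∀

a[kr]²≡k[akrr] : ∀ a k r → a * ((k * r) * (k * r)) ≡ k * (a * k * r * r)
a[kr]²≡k[akrr] = solve-∀

m≤m*m : ∀ m → m ≤ m * m
m≤m*m zero    = z≤n
m≤m*m (suc m) = m≤m*n (suc m) (suc m)

a*-square-mono-≤ : ∀ a {x y} → x ≤ y → a * (x * x) ≤ a * (y * y)
a*-square-mono-≤ a x≤y = *-monoʳ-≤ a (*-mono-≤ x≤y x≤y)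

SquarePairAbove-≤ : ∀ {A M N} → M ≤ N → SquarePairAbove A N → SquarePairAbove A M
SquarePairAbove-≤ M≤N (b , y , 2≤y , N≤by² , b∈A , by²∈A) = b , y , 2≤y , ≤-trans M≤N N≤by² , b∈A , by²∈A

module _ {k : ℕ} {A : ℕ → Set} (covers : ∀ n → 1 ≤ n → A n ⊎ A (n + k)) where

  square-pair-above : ∀ {a x u} → A a → 1 ≤ a → 2 ≤ x → 1 ≤ u →
                      a * (x * x) ≡ k * u → SquarePairAbove A (a * (x * x))
  square-pair-above {a} {x} {u} a∈A 1≤a 2≤x 1≤u ax²≡ku = cover-ax² (covers (a * (x * x)) 1≤ax²)
    where
    s z w : ℕ
    s = 3 + 4 * u
    z = 1 + 4 * u
    w = x * s

    1≤x : 1 ≤ x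
    1≤x = ≤-trans (s≤s z≤n) 2≤x

    1≤ax² : 1 ≤ a * (x * x)
    1≤ax² = *-mono-≤ 1≤a (*-mono-≤ 1≤x 1≤x)

    x≤w : x ≤ w
    x≤w = m≤m*n x s

    ax²≤aw² : a * (x * x) ≤ a * (w * w)
    ax²≤aw² = a*-square-mono-≤ a x≤w

    aw²+k≡[ax²+k]z² : a * (w * w) + k ≡ (a * (x * x) + k) * (z * z)
    aw²+k≡[ax²+k]z² = begin
      a * (w * w) + k             ≡⟨ cong (_+ k) (a[xs]²≡ax²s² a x s) ⟩
      a * (x * x) * (s * s) + k   ≡⟨ cong (λ m → m * (s * s) + k) ax²≡ku ⟩
      k * u * (s * s) + k         ≡⟨ ku[4u+3]²+k≡[ku+k][4u+1]² k u ⟩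
      (k * u + k) * (z * z)       ≡⟨ cong (λ m → (m + k) * (z * z)) (sym ax²≡ku) ⟩
      (a * (x * x) + k) * (z * z) ∎
      where open ≡-Reasoning

    cover-aw² : A (a * (x * x) + k) → A (a * (w * w)) ⊎ A (a * (w * w) + k) →
                SquarePairAbove A (a * (x * x))
    cover-aw² _ (inj₁ aw²∈A) = a , w , ≤-trans 2≤x x≤w , ax²≤aw² , a∈A , aw²∈A
    cover-aw² ax²+k∈A (inj₂ aw²+k∈A) =
      a * (x * x) + k , z , s≤s (≤-trans 1≤u (m≤n*m u 4)) ,
      ≤-trans (m≤m+n _ k) (m≤m*n _ (z * z)) , ax²+k∈A , subst A aw²+k≡[ax²+k]z² aw²+k∈A

    cover-ax² : A (a * (x * x)) ⊎ A (a * (x * x) + k) → SquarePairAbove A (a * (x * x))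
    cover-ax² (inj₁ ax²∈A)   = a , x , 2≤x , ≤-refl , a∈A , ax²∈A
    cover-ax² (inj₂ ax²+k∈A) = cover-aw² ax²+k∈A (covers (a * (w * w)) (≤-trans 1≤ax² ax²≤aw²))

theorem4 : (k : ℕ) → 1 ≤ k → (A : ℕ → Set)
    → (∀ a → A a → 1 ≤ a)
    → InfinitelyMany (λ a → A a × A (a + k))
    → (∀ a → 1 ≤ a → A a ⊎ A (a + k))
    → ∀ (N : ℕ) → ∃[ a ] ∃[ x ] (2 ≤ x × N ≤ a * (x * x) × A a × A (a * (x * x)))
theorem4 k 1≤k A positive infinitelyMany covers N with infinitelyMany 0
... | a , _ , a∈A , _ =
  SquarePairAbove-≤ N≤ax² (square-pair-above covers a∈A 1≤a 2≤x 1≤u (a[kr]²≡k[akrr] a k r))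
  where
  r x u : ℕ
  r = 2 + N
  x = k * r
  u = a * k * r * r

  1≤a : 1 ≤ a
  1≤a = positive a a∈A

  r≤x : r ≤ x
  r≤x = m≤n*m r k {{>-nonZero 1≤k}}

  2≤x : 2 ≤ x
  2≤x = ≤-trans (m≤m+n 2 N) r≤x

  1≤u : 1 ≤ u
  1≤u = *-mono-≤ (*-mono-≤ (*-mono-≤ 1≤a 1≤k) (s≤s z≤n)) (s≤s z≤n)

  N≤ax² : N ≤ a * (x * x)
  N≤ax² = begin
    N           ≤⟨ m≤n+m N 2 ⟩
    r           ≤⟨ r≤x ⟩
    x           ≤⟨ m≤m*m x ⟩
    x * x       ≤⟨ m≤n*m (x * x) a {{>-nonZero 1≤a}} ⟩
    a * (x * x) ∎
    where open ≤-Reasoning
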